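{- Let $k \ge 1$ be an integer, $X \in \Sigma^*$ be a string with $\mathsf{self}\text{ - }\mathsf{ed}(X) \le k$, and $X_0,\ldots,X_{\ell-1}$ be a partitioning of $X$ (i.e., $X=X_0X_1\cdots X_{\ell-1}$). Then $\sum_{i=0}^{\ell-1} \mathsf{sed}^k(X_i) \le \mathsf{self}\text{ - }\mathsf{ed}(X)$.
   Context: Let $\mathsf{AG}(X,X)$ be the unweighted alignment graph: vertices $[0.\,.|X|]^2$, edges $(x,y)\to(x+1,y)$ and $(x,y)\to(x,y+1)$ of cost $1$, and $(x,y)\to(x+1,y+1)$ of cost $0$ if $X[x]=X[y]$ and $1$ otherwise. A self-alignment of $X$ is a path from $(0,0)$ to $(|X|,|X|)$ in $\mathsf{AG}(X,X)$ not using any edge of the main diagonal (i.e., never aligning $X[x]$ with itself); $\mathsf{self}\text{ - }\mathsf{ed}(X)$ is the minimum cost of a self-alignment. For an integer $k\ge1$, let $G$ be $\mathsf{AG}(X,X)$ with all main-diagonal edges $(x,x)\to(x+1,x+1)$ removed; the $k$-shifted self-edit distance is $\mathsf{sed}^k(X)=\min\{\mathsf{dist}_G((x,0),(|X|,y)) : x\in[0.\,.\min(|X|,k)],\ y\in[\max(0,|X|-k).\,.|X|]\}$. -}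

module Defs where

open import Data.Nat using (ℕ; zero; suc; _+_; _≤_; _<_; _∸_; _⊓_)
open import Data.Product using (_×_; _,_; Σ; ∃-syntax)
open import Data.List using (List; length; lookup)
open import Data.Fin using (Fin; toℕ)
open import Relation.Binary.Definitions using (DecidableEquality)
open import Relation.Binary.PropositionalEquality using (_≡_; _≢_)
open import Relation.Nullary using (yes; no)

Vertex : Set
Vertex = ℕ × ℕ

module _ {A : Set} (_≟_ : DecidableEquality A) where

  mismatch : A → A → ℕ
  mismatch a b with a ≟ b
  ... | yes _ = 0
  ... | no _  = 1

  -- Edges of G = AG(X,X) with all main-diagonal edges (x,x)→(x+1,x+1) removed,
  -- indexed by their cost.  Vertices range over [0..|X|]^2.
  data Edge (X : List A) : Vertex → Vertex → ℕ → Set where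
    right : (i : Fin (length X)) (y : ℕ) → y ≤ length X →
            Edge X (toℕ i , y) (suc (toℕ i) , y) 1
    down  : (x : ℕ) (j : Fin (length X)) → x ≤ length X →
            Edge X (x , toℕ j) (x , suc (toℕ j)) 1
    diag  : (i j : Fin (length X)) → toℕ i ≢ toℕ j →
            Edge X (toℕ i , toℕ j) (suc (toℕ i) , suc (toℕ j))
                   (mismatch (lookup X i) (lookup X j))

  data Path (X : List A) : Vertex → Vertex → ℕ → Set where
    []  : ∀ {u} → Path X u u 0
    _∷_ : ∀ {u v w c d} → Edge X u v c → Path X v w d → Path X u w (c + d)

  IsSelfEd : List A → ℕ → Set
  IsSelfEd X d =
    Path X (0 , 0) (length X , length X) d ×
    (∀ c → Path X (0 , 0) (length X , length X) c → d ≤ c)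

  StartOK : ℕ → List A → ℕ → Set
  StartOK k X x = x ≤ length X ⊓ k

  EndOK : ℕ → List A → ℕ → Set
  EndOK k X y = (length X ∸ k ≤ y) × (y ≤ length X)

  IsSed : ℕ → List A → ℕ → Set
  IsSed k X d =
    (∃[ x ] ∃[ y ] (StartOK k X x × EndOK k X y × Path X (x , 0) (length X , y) d)) ×
    (∀ x y c → StartOK k X x → EndOK k X y → Path X (x , 0) (length X , y) c → d ≤ c)

{-# OPTIONS --safe #-}
-- G is symmetric under (x , y) ↦ (y , x), so folding an optimal self-alignment into the
-- triangle y ≤ x yields a walk of the same cost d ≤ k from (0 , 0) to (|X| , |X|), whose
-- column exceeds its row by at most the cost still to be paid. Take the blocks in order and
-- let the walk enter the square of the block B = X[s . . s + |B|) on row s, at column s + p.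
-- If p ≥ |B| then |B| ≤ k, so the empty path at (|B| , 0) shows sed^k(B) = 0. Otherwise the
-- walk up to column s + |B|, shifted by (s , s), is a path of G(B) from (p , 0) to (|B| , q)
-- with p ≤ k and |B| − q ≤ k, so it costs at least sed^k(B). The rest of the walk, from row
-- s + |B| on, is disjoint from these pieces and accounts for the later blocks.

module Submission where

open import Defs
open import Data.Nat
  using (ℕ; zero; suc; _+_; _∸_; _⊓_; _⊔_; _≤_; _<_; _≤?_; _<?_; z≤n; s≤s; s≤s⁻¹)
  renaming (_≟_ to _≟ℕ_)
open import Data.Nat.Properties
open import Data.Nat.ListAction using (sum)
open import Data.List using (List; []; _∷_; _++_; concat; length; lookup)
open import Data.List.Properties using (length-++)
open import Data.List.Relation.Binary.Pointwise using (Pointwise; []; _∷_)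
open import Data.Maybe using (Maybe; just; nothing)
open import Data.Fin using (Fin; toℕ; fromℕ<)
open import Data.Fin.Properties using (toℕ-fromℕ<)
open import Data.Product using (∃-syntax; _×_; _,_)
open import Relation.Nullary using (yes; no)
open import Relation.Nullary.Negation using (contradiction)
open import Relation.Binary.Definitions using (DecidableEquality)
open import Relation.Binary.PropositionalEquality
  using (_≡_; _≢_; refl; sym; trans; cong; cong₂; subst; subst₂)

fold : Vertex → Vertex
fold (x , y) = (x ⊔ y , x ⊓ y)

fold-≥ : ∀ {x y} → y ≤ x → fold (x , y) ≡ (x , y)
fold-≥ y≤x = cong₂ _,_ (m≥n⇒m⊔n≡m y≤x) (m≥n⇒m⊓n≡n y≤x)

fold-≤ : ∀ {x y} → x ≤ y → fold (x , y) ≡ (y , x)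
fold-≤ x≤y = cong₂ _,_ (m≤n⇒m⊔n≡n x≤y) (m≤n⇒m⊓n≡m x≤y)

module _ {A : Set} (_≟_ : DecidableEquality A) where

  mismatch-comm : ∀ a b → mismatch _≟_ a b ≡ mismatch _≟_ b a
  mismatch-comm a b with a ≟ b | b ≟ a
  ... | yes _   | yes _   = refl
  ... | no _    | no _    = refl
  ... | yes a≡b | no b≢a  = contradiction (sym a≡b) b≢a
  ... | no a≢b  | yes b≡a = contradiction (sym b≡a) a≢b

  at : List A → ℕ → Maybe A
  at []       _       = nothing
  at (a ∷ _)  zero    = just a
  at (_ ∷ as) (suc x) = at as x

  at-lookup : ∀ X (i : Fin (length X)) → at X (toℕ i) ≡ just (lookup X i)
  at-lookup (_ ∷ _)  Fin.zero    = refl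
  at-lookup (_ ∷ as) (Fin.suc i) = at-lookup as i

  at-++ˡ : ∀ P {Y x} → x < length P → at (P ++ Y) x ≡ at P x
  at-++ˡ (_ ∷ _) {x = zero}  _   = refl
  at-++ˡ (_ ∷ P) {x = suc x} x<n = at-++ˡ P (s≤s⁻¹ x<n)

  -- Out-of-range positions get the junk cost 0; walks below only use in-range ones.
  mismatch? : Maybe A → Maybe A → ℕ
  mismatch? (just a) (just b) = mismatch _≟_ a b
  mismatch? _        _        = 0

  mismatchAt : List A → ℕ → ℕ → ℕ
  mismatchAt X x y = mismatch? (at X x) (at X y)

  mismatchAt-lookup : ∀ X (i j : Fin (length X)) →
                      mismatchAt X (toℕ i) (toℕ j) ≡ mismatch _≟_ (lookup X i) (lookup X j)
  mismatchAt-lookup X i j = cong₂ mismatch? (at-lookup X i) (at-lookup X j)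

  mismatchAt-++ˡ : ∀ P {Y x y} → x < length P → y < length P →
                   mismatchAt (P ++ Y) x y ≡ mismatchAt P x y
  mismatchAt-++ˡ P x<n y<n = cong₂ mismatch? (at-++ˡ P x<n) (at-++ˡ P y<n)

  rightEdge : ∀ {X x y} → x < length X → y ≤ length X → Edge _≟_ X (x , y) (suc x , y) 1
  rightEdge x<n y≤n with fromℕ< x<n | toℕ-fromℕ< x<n
  ... | i | refl = right i _ y≤n

  downEdge : ∀ {X x y} → x ≤ length X → y < length X → Edge _≟_ X (x , y) (x , suc y) 1
  downEdge x≤n y<n with fromℕ< y<n | toℕ-fromℕ< y<n
  ... | j | refl = down _ j x≤n

  diagEdge : ∀ {X x y} → x < length X → y < length X → x ≢ y →
             Edge _≟_ X (x , y) (suc x , suc y) (mismatchAt X x y)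
  diagEdge {X} x<n y<n x≢y with fromℕ< x<n | toℕ-fromℕ< x<n | fromℕ< y<n | toℕ-fromℕ< y<n
  ... | i | refl | j | refl = subst (Edge _≟_ X _ _) (sym (mismatchAt-lookup X i j)) (diag i j x≢y)

  data LowerStep (X : List A) : Vertex → Vertex → ℕ → Set where
    right : ∀ {x y} → y ≤ x → LowerStep X (x , y) (suc x , y) 1
    down  : ∀ {x y} → y < x → LowerStep X (x , y) (x , suc y) 1
    diag  : ∀ {x y} → y < x → LowerStep X (x , y) (suc x , suc y) (mismatchAt X x y)

  data LowerWalk (X : List A) : Vertex → Vertex → ℕ → Set where
    []  : ∀ {u} → LowerWalk X u u 0
    _∷_ : ∀ {u v w c d} → LowerStep X u v c → LowerWalk X v w d → LowerWalk X u w (c + d)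

  castStep : ∀ {X u v u′ v′ c c′} → u ≡ u′ → v ≡ v′ → c′ ≡ c →
             LowerStep X u′ v′ c′ → LowerStep X u v c
  castStep refl refl refl s = s

  foldEdge : ∀ {X u v c} → Edge _≟_ X u v c → LowerStep X (fold u) (fold v) c
  foldEdge (right i _ _) with _ ≤? toℕ i
  ... | yes y≤i = castStep (fold-≥ y≤i) (fold-≥ (m≤n⇒m≤1+n y≤i)) refl (right y≤i)
  ... | no  y≰i = castStep (fold-≤ (<⇒≤ i<y)) (fold-≤ i<y) refl (down i<y)
    where i<y = ≰⇒> y≰i
  foldEdge (down _ j _) with toℕ j <? _
  ... | yes j<x = castStep (fold-≥ (<⇒≤ j<x)) (fold-≥ j<x) refl (down j<x)
  ... | no  j≮x = castStep (fold-≤ x≤j) (fold-≤ (m≤n⇒m≤1+n x≤j)) refl (right x≤j)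
    where x≤j = ≮⇒≥ j≮x
  foldEdge {X} (diag i j i≢j) with toℕ j <? toℕ i
  ... | yes j<i = castStep (fold-≥ (<⇒≤ j<i)) (fold-≥ (s≤s (<⇒≤ j<i)))
                           (mismatchAt-lookup X i j) (diag j<i)
  ... | no  j≮i = castStep (fold-≤ (<⇒≤ i<j)) (fold-≤ (s≤s (<⇒≤ i<j)))
                           (trans (mismatchAt-lookup X j i) (mismatch-comm _ _)) (diag i<j)
    where i<j = ≤∧≢⇒< (≮⇒≥ j≮i) i≢j

  foldPath : ∀ {X u w c} → Path _≟_ X u w c → LowerWalk X (fold u) (fold w) c
  foldPath []      = []
  foldPath (e ∷ p) = foldEdge e ∷ foldPath p

  step-x≤1+x : ∀ {X x y x′ y′ c} → LowerStep X (x , y) (x′ , y′) c → x′ ≤ suc x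
  step-x≤1+x (right _) = ≤-refl
  step-x≤1+x (down _)  = n≤1+n _
  step-x≤1+x (diag _)  = ≤-refl

  step-y≤1+y : ∀ {X x y x′ y′ c} → LowerStep X (x , y) (x′ , y′) c → y′ ≤ suc y
  step-y≤1+y (right _) = n≤1+n _
  step-y≤1+y (down _)  = ≤-refl
  step-y≤1+y (diag _)  = ≤-refl

  walk-x≤x′ : ∀ {X x y x′ y′ c} → LowerWalk X (x , y) (x′ , y′) c → x ≤ x′
  walk-x≤x′ []             = ≤-refl
  walk-x≤x′ (right _ ∷ w)  = <⇒≤ (walk-x≤x′ w)
  walk-x≤x′ (down _ ∷ w)   = walk-x≤x′ w
  walk-x≤x′ (diag _ ∷ w)   = <⇒≤ (walk-x≤x′ w)

  walk-lower : ∀ {X x y x′ y′ c} → LowerWalk X (x , y) (x′ , y′) c → y′ ≤ x′ → y ≤ x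
  walk-lower []              y′≤x′ = y′≤x′
  walk-lower (right y≤x ∷ _) _     = y≤x
  walk-lower (down y<x ∷ _)  _     = <⇒≤ y<x
  walk-lower (diag y<x ∷ _)  _     = <⇒≤ y<x

  -- Only down steps decrease the gap x − y, and each of them costs 1.
  walk-x≤y+cost : ∀ {X x y n c} → LowerWalk X (x , y) (n , n) c → x ≤ y + c
  walk-x≤y+cost {y = y} []            = m≤m+n y 0
  walk-x≤y+cost {y = y} (right _ ∷ w) = ≤-trans (<⇒≤ (walk-x≤y+cost w)) (+-monoʳ-≤ y (n≤1+n _))
  walk-x≤y+cost {y = y} (down _ ∷ w)  = ≤-trans (walk-x≤y+cost w) (≤-reflexive (sym (+-suc y _)))
  walk-x≤y+cost {y = y} (diag _ ∷ w)  = ≤-trans (s≤s⁻¹ (walk-x≤y+cost w)) (+-monoʳ-≤ y (m≤n+m _ _))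

  suffixFromRow : ∀ {X x y x′ y′ c} t →
                  LowerWalk X (x , y) (x′ , y′) c → y ≤ t → t ≤ y′ →
                  ∃[ x₁ ] ∃[ c₁ ] LowerWalk X (x₁ , t) (x′ , y′) c₁ × c₁ ≤ c
  suffixFromRow {y = y} t w y≤t t≤y′ with y ≟ℕ t
  ... | yes refl = _ , _ , w , ≤-refl
  suffixFromRow t [] y≤t t≤y′ | no y≢t = contradiction (≤-antisym y≤t t≤y′) y≢t
  suffixFromRow t (s ∷ w) y≤t t≤y′ | no y≢t =
    let x₁ , c₁ , w₁ , c₁≤d = suffixFromRow t w (≤-trans (step-y≤1+y s) (≤∧≢⇒< y≤t y≢t)) t≤y′
    in x₁ , c₁ , w₁ , ≤-trans c₁≤d (m≤n+m _ _)

  splitAtColumn : ∀ {X x y x′ y′ c} t →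
                  LowerWalk X (x , y) (x′ , y′) c → x ≤ t → t ≤ x′ →
                  ∃[ q ] ∃[ c₁ ] ∃[ c₂ ] LowerWalk X (x , y) (t , q) c₁ ×
                                         LowerWalk X (t , q) (x′ , y′) c₂ × c₁ + c₂ ≡ c
  splitAtColumn {x = x} t w x≤t t≤x′ with x ≟ℕ t
  ... | yes refl = _ , 0 , _ , [] , w , refl
  splitAtColumn t [] x≤t t≤x′ | no x≢t = contradiction (≤-antisym x≤t t≤x′) x≢t
  splitAtColumn t (s ∷ w) x≤t t≤x′ | no x≢t =
    let q , c₁ , c₂ , w₁ , w₂ , c₁+c₂≡d =
          splitAtColumn t w (≤-trans (step-x≤1+x s) (≤∧≢⇒< x≤t x≢t)) t≤x′
    in q , _ , c₂ , s ∷ w₁ , w₂ , trans (+-assoc _ c₁ c₂) (cong (_ +_) c₁+c₂≡d)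

  prefixEdge : ∀ P {Y u x y c} →
               LowerStep (P ++ Y) u (x , y) c → x ≤ length P → Edge _≟_ P u (x , y) c
  prefixEdge P (right y≤x) x<n = rightEdge x<n (≤-trans y≤x (<⇒≤ x<n))
  prefixEdge P (down y<x)  x≤n = downEdge x≤n (<-≤-trans y<x x≤n)
  prefixEdge P (diag y<x)  x<n =
    subst (Edge _≟_ P _ _) (sym (mismatchAt-++ˡ P x<n y<n)) (diagEdge x<n y<n (>⇒≢ y<x))
    where y<n = <-trans y<x x<n

  prefixPath : ∀ P {Y u x y c} →
               LowerWalk (P ++ Y) u (x , y) c → x ≤ length P → Path _≟_ P u (x , y) c
  prefixPath P []      _   = []
  prefixPath P (s ∷ w) x≤n = prefixEdge P s (≤-trans (walk-x≤x′ w) x≤n) ∷ prefixPath P w x≤n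

  dropHead : ∀ {a Y x y x′ y′ c} →
             LowerWalk (a ∷ Y) (suc x , suc y) (suc x′ , suc y′) c → LowerWalk Y (x , y) (x′ , y′) c
  dropHead []                   = []
  dropHead (right (s≤s y≤x) ∷ w) = right y≤x ∷ dropHead w
  dropHead (down (s≤s y<x) ∷ w)  = down y<x ∷ dropHead w
  dropHead (diag (s≤s y<x) ∷ w)  = diag y<x ∷ dropHead w

  dropPrefix : ∀ P {Y x y x′ y′ c} →
               LowerWalk (P ++ Y) (length P + x , length P + y) (length P + x′ , length P + y′) c →
               LowerWalk Y (x , y) (x′ , y′) c
  dropPrefix []      w = w
  dropPrefix (_ ∷ P) w = dropPrefix P (dropHead w)

  module _ (k : ℕ) where

    sed+rest≤cost : ∀ {B Y x n c d} → IsSed _≟_ k B d →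
                    LowerWalk (B ++ Y) (x , 0) (n , n) c → c ≤ k → length B ≤ n →
                    ∃[ x₁ ] ∃[ c₁ ] LowerWalk (B ++ Y) (x₁ , length B) (n , n) c₁ × d + c₁ ≤ c
    sed+rest≤cost {B} {x = x} (_ , minimal) w c≤k L≤n with length B ≤? x
    ... | yes L≤x =
      let x₁ , c₁ , w₁ , c₁≤c = suffixFromRow L w z≤n L≤n
          d≤0 = minimal L 0 0 (⊓-glb ≤-refl L≤k) (≤-reflexive (m≤n⇒m∸n≡0 L≤k) , z≤n) []
      in x₁ , c₁ , w₁ , +-mono-≤ d≤0 c₁≤c
      where
        L = length B
        L≤k = ≤-trans L≤x (≤-trans (walk-x≤y+cost w) c≤k)
    ... | no L≰x =
      let q , c₁ , c₂ , w₁ , w₂ , c₁+c₂≡c = splitAtColumn L w x≤L L≤n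
          q≤L = walk-lower w₂ ≤-refl
          c₂≤k = ≤-trans (m≤n+m c₂ c₁) (≤-trans (≤-reflexive c₁+c₂≡c) c≤k)
          L≤k+q = ≤-trans (walk-x≤y+cost w₂) (≤-trans (+-monoʳ-≤ q c₂≤k) (≤-reflexive (+-comm q k)))
          d≤c₁ = minimal x q c₁ (⊓-glb x≤L x≤k) (m≤n+o⇒m∸n≤o L k L≤k+q , q≤L)
                         (prefixPath B w₁ ≤-refl)
          x₃ , c₃ , w₃ , c₃≤c₂ = suffixFromRow L w₂ q≤L L≤n
      in x₃ , c₃ , w₃ , ≤-trans (+-mono-≤ d≤c₁ c₃≤c₂) (≤-reflexive c₁+c₂≡c)
      where
        L = length B
        x≤L = <⇒≤ (≰⇒> L≰x)
        x≤k = ≤-trans (walk-x≤y+cost w) c≤k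

    sum-sed≤cost : ∀ Xs {ds x c} → Pointwise (IsSed _≟_ k) Xs ds →
                   LowerWalk (concat Xs) (x , 0) (length (concat Xs) , length (concat Xs)) c →
                   c ≤ k → sum ds ≤ c
    sum-sed≤cost []       []           _ _   = z≤n
    sum-sed≤cost (B ∷ Xs) {d ∷ _} (sed ∷ seds) w c≤k =
      let x₁ , c₁ , w₁ , d+c₁≤c = sed+rest≤cost sed w c≤k L≤n
          c₁≤k = ≤-trans (m≤n+m c₁ d) (≤-trans d+c₁≤c c≤k)
      in ≤-trans (+-monoʳ-≤ d (sum-sed≤cost Xs seds (dropPrefix B (shift w₁)) c₁≤k)) d+c₁≤c
      where
        L = length B
        Y = concat Xs
        L≤n : L ≤ length (B ++ Y)
        L≤n = subst (L ≤_) (sym (length-++ B)) (m≤m+n L (length Y))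
        shift : ∀ {x₁ c₁} →
                LowerWalk (B ++ Y) (x₁ , L) (length (B ++ Y) , length (B ++ Y)) c₁ →
                LowerWalk (B ++ Y) (L + (x₁ ∸ L) , L + 0) (L + length Y , L + length Y) c₁
        shift w₁ = subst₂ (λ u v → LowerWalk (B ++ Y) u v _)
          (cong₂ _,_ (sym (m+[n∸m]≡n (walk-lower w₁ ≤-refl))) (sym (+-identityʳ L)))
          (cong₂ _,_ (length-++ B) (length-++ B)) w₁

lemmaB5 : {A : Set} (_≟_ : DecidableEquality A) (k : ℕ) → 1 ≤ k →
          (X : List A) (d : ℕ) → IsSelfEd _≟_ X d → d ≤ k →
          (Xs : List (List A)) → concat Xs ≡ X →
          (ds : List ℕ) → Pointwise (IsSed _≟_ k) Xs ds →
          sum ds ≤ d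
lemmaB5 _≟_ k _ X d (alignment , _) d≤k Xs refl ds seds = sum-sed≤cost _≟_ k Xs seds folded d≤k
  where
    folded : LowerWalk _≟_ X (0 , 0) (length X , length X) d
    folded = subst (λ v → LowerWalk _≟_ X (0 , 0) v d) (fold-≥ ≤-refl) (foldPath _≟_ alignment)
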